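{- Let $P=(X,\prec)$ be a finite twin-free interval order with no induced subposet isomorphic to any of $\mathbf{4}+\mathbf{1}$, $\mathbf{3}+\mathbf{1}+\mathbf{1}$, $Z$, $D$, $Y$, or the dual of $Y$, and let $\mathcal{I}=\{I(z):z\in X\}$ be a closed interval representation of $P$ satisfying: (1) no interval strictly contains two other intervals; (2) no interval is strictly contained in two other intervals; (3) whenever $I(u)\subsetneq I(v)$ there are unique $x,y\in X$ with $x$ peeking into $vu$ from the left and $y$ peeking into $vu$ from the right. Fix any $u,v$ with $I(u)\subsetneq I(v)$, with unique left peeker $x$ and right peeker $y$, and define $\hat{\mathcal{I}}$ by $\hat I(x)=[L(x),L(v)]$, $\hat I(y)=[R(v),R(y)]$, and $\hat I(w)=I(w)$ for all other $w$. Then $\hat{\mathcal{I}}$ is also a closed interval representation of $P$, it also satisfies (1), (2), (3), and it has the same proper inclusions as $\mathcal{I}$ (i.e., $\hat I(a)\subsetneq\hat I(b)$ iff $I(a)\subsetneq I(b)$ for all $a,b\in X$).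
   Context: Posets are strict partial orders on a finite set; induced subposet means restriction to a subset, up to isomorphism. A closed interval representation assigns to each $x$ a closed interval $I(x)=[L(x),R(x)]$ with $x\prec y$ iff $R(x)<L(y)$; an interval order is a poset having one. $I(u)$ is strictly contained in $I(v)$ if $I(u)\subset I(v)$ and they do not have identical endpoints. Twins are elements with exactly the same comparabilities; twin-free means none. For $I(u)\subset I(v)$, $x$ peeks into $vu$ if $I(x)$ meets $I(v)$ but not $I(u)$; from the left if also $R(x)\le L(u)$, from the right if also $R(u)\le L(x)$. The posets (listed comparabilities plus transitive consequences, other pairs incomparable): $\mathbf{4}+\mathbf{1}$ on $\{a,b,c,d,x\}$ with $a\prec b\prec c\prec d$; $\mathbf{3}+\mathbf{1}+\mathbf{1}$ on $\{a,b,c,x,y\}$ with $a\prec b\prec c$; $Z$ on $\{a,b,c,d,x,y\}$ with $a\prec b\prec c\prec d$, $x\prec d$, $a\prec y$; $D$ on $\{a,b,c,d,x\}$ with $a\prec b\prec d$, $a\prec c\prec d$; $Y$ on $\{a,b,c,d,x\}$ with $a\prec d\prec b$, $a\prec d\prec c$; the dual reverses all comparabilities. -}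

module Defs where

open import Level using (Level; 0ℓ; _⊔_)
open import Data.Nat using (ℕ; zero; suc)
open import Data.Bool using (Bool; true; false; T; _∧_; _∨_)
open import Data.Fin using (Fin; toℕ; _≟_)
open import Data.Product using (Σ; _×_; _,_; ∃)
open import Data.Sum using (_⊎_)
open import Relation.Nullary using (¬_; yes; no)
open import Relation.Binary using (Rel; StrictTotalOrder; IsStrictPartialOrder)
open import Relation.Binary.PropositionalEquality using (_≡_; _≢_)
open import Function.Bundles using (_⇔_)
open import Function.Definitions using (Injective)

IsPoset : ∀ {n} → Rel (Fin n) 0ℓ → Set
IsPoset _≺_ = IsStrictPartialOrder _≡_ _≺_

Twins : ∀ {n} → Rel (Fin n) 0ℓ → Fin n → Fin n → Set
Twins {n} _≺_ x y = (z : Fin n) → ((z ≺ x) ⇔ (z ≺ y)) × ((x ≺ z) ⇔ (y ≺ z))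

TwinFree : ∀ {n} → Rel (Fin n) 0ℓ → Set
TwinFree _≺_ = ∀ x y → Twins _≺_ x y → x ≡ y

ContainsInduced : ∀ {n k} → Rel (Fin n) 0ℓ → Rel (Fin k) 0ℓ → Set
ContainsInduced {n} {k} _≺_ Q =
  Σ (Fin k → Fin n) λ f → Injective _≡_ _≡_ f × (∀ i j → Q i j ⇔ (f i ≺ f j))

-- small posets given by Boolean tables on indices (transitively closed)
fromTable : (k : ℕ) → (ℕ → ℕ → Bool) → Rel (Fin k) 0ℓ
fromTable k t i j = T (t (toℕ i) (toℕ j))

-- 4+1 on a=0,b=1,c=2,d=3,x=4 : a<b<c<d
t4+1 : ℕ → ℕ → Bool
t4+1 0 1 = true
t4+1 0 2 = true
t4+1 0 3 = true
t4+1 1 2 = true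
t4+1 1 3 = true
t4+1 2 3 = true
t4+1 _ _ = false

-- 3+1+1 on a=0,b=1,c=2,x=3,y=4 : a<b<c
t3+1+1 : ℕ → ℕ → Bool
t3+1+1 0 1 = true
t3+1+1 0 2 = true
t3+1+1 1 2 = true
t3+1+1 _ _ = false

-- Z on a=0,b=1,c=2,d=3,x=4,y=5 : a<b<c<d, x<d, a<y
tZ : ℕ → ℕ → Bool
tZ 0 1 = true
tZ 0 2 = true
tZ 0 3 = true
tZ 1 2 = true
tZ 1 3 = true
tZ 2 3 = true
tZ 4 3 = true
tZ 0 5 = true
tZ _ _ = false

-- D on a=0,b=1,c=2,d=3,x=4 : a<b<d, a<c<d
tD : ℕ → ℕ → Bool
tD 0 1 = true
tD 0 2 = true
tD 0 3 = true
tD 1 3 = true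
tD 2 3 = true
tD _ _ = false

-- Y on a=0,b=1,c=2,d=3,x=4 : a<d<b, a<d<c
tY : ℕ → ℕ → Bool
tY 0 3 = true
tY 3 1 = true
tY 3 2 = true
tY 0 1 = true
tY 0 2 = true
tY _ _ = false

Four+One : Rel (Fin 5) 0ℓ
Four+One = fromTable 5 t4+1

Three+One+One : Rel (Fin 5) 0ℓ
Three+One+One = fromTable 5 t3+1+1

PosetZ : Rel (Fin 6) 0ℓ
PosetZ = fromTable 6 tZ

PosetD : Rel (Fin 5) 0ℓ
PosetD = fromTable 5 tD

PosetY : Rel (Fin 5) 0ℓ
PosetY = fromTable 5 tY

PosetYdual : Rel (Fin 5) 0ℓ
PosetYdual i j = PosetY j i

Forbidden : ∀ {n} → Rel (Fin n) 0ℓ → Set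
Forbidden _≺_ =
  ¬ ContainsInduced _≺_ Four+One × ¬ ContainsInduced _≺_ Three+One+One ×
  ¬ ContainsInduced _≺_ PosetZ × ¬ ContainsInduced _≺_ PosetD ×
  ¬ ContainsInduced _≺_ PosetY × ¬ ContainsInduced _≺_ PosetYdual

-- Closed interval representations with endpoints in an arbitrary
-- strict total order (covers ℝ, ℚ, ...)

module Intervals {c ℓ₁ ℓ₂} (A : StrictTotalOrder c ℓ₁ ℓ₂) where
  open StrictTotalOrder A using (_≈_; _<_) renaming (Carrier to E)

  _≤_ : E → E → Set (ℓ₁ ⊔ ℓ₂)
  a ≤ b = (a < b) ⊎ (a ≈ b)

  module _ {n : ℕ} where

    IsRep : Rel (Fin n) 0ℓ → (Fin n → E) → (Fin n → E) → Set (ℓ₁ ⊔ ℓ₂)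
    IsRep _≺_ L R = (∀ x → L x ≤ R x) × (∀ x y → (x ≺ y) ⇔ (R x < L y))

    module _ (L R : Fin n → E) where

      Sub : Fin n → Fin n → Set (ℓ₁ ⊔ ℓ₂)
      Sub u v = (L v ≤ L u) × (R u ≤ R v)

      SSub : Fin n → Fin n → Set (ℓ₁ ⊔ ℓ₂)
      SSub u v = Sub u v × ¬ ((L u ≈ L v) × (R u ≈ R v))

      Meets : Fin n → Fin n → Set (ℓ₁ ⊔ ℓ₂)
      Meets x v = (L x ≤ R v) × (L v ≤ R x)

      Peeks : Fin n → Fin n → Fin n → Set (ℓ₁ ⊔ ℓ₂)
      Peeks x v u = Meets x v × ¬ Meets x u

      PeeksLeft : Fin n → Fin n → Fin n → Set (ℓ₁ ⊔ ℓ₂)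
      PeeksLeft x v u = Peeks x v u × (R x ≤ L u)

      PeeksRight : Fin n → Fin n → Fin n → Set (ℓ₁ ⊔ ℓ₂)
      PeeksRight y v u = Peeks y v u × (R u ≤ L y)

      Cond1 : Set (ℓ₁ ⊔ ℓ₂)
      Cond1 = ∀ v a b → SSub a v → SSub b v → a ≡ b

      Cond2 : Set (ℓ₁ ⊔ ℓ₂)
      Cond2 = ∀ u a b → SSub u a → SSub u b → a ≡ b

      Cond3 : Set (ℓ₁ ⊔ ℓ₂)
      Cond3 = ∀ u v → SSub u v →
        (Σ (Fin n) λ x → PeeksLeft x v u × (∀ x' → PeeksLeft x' v u → x' ≡ x)) ×
        (Σ (Fin n) λ y → PeeksRight y v u × (∀ y' → PeeksRight y' v u → y' ≡ y))

    hatL : (L R : Fin n → E) (v x y : Fin n) → Fin n → E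
    hatL L R v x y w with w ≟ y
    ... | yes _ = R v
    ... | no _ = L w

    hatR : (L R : Fin n → E) (v x y : Fin n) → Fin n → E
    hatR L R v x y w with w ≟ x
    ... | yes _ = L v
    ... | no _ = R w

-- The proof is a "no endpoint crosses" argument:
--
--  * By (1)-(3), no left endpoint lies in (L v, R x], no right endpoint lies
--    in [L y, R v), no right endpoint other than R x lies in [L v, R x], and
--    no left endpoint other than L y lies in [L y, R v]  (Configuration).
--  * Moving a point across a gap that contains no other relevant endpoint
--    changes none of its comparisons (EndpointOrder, PointUpdate).  Hence
--    every comparison R a < L b is unchanged, so the order is still
--    represented, and every comparison L a ≤ L b, R a ≤ R b is unchanged,
--    so the strict containments are the same  (Modification).
--  * Peeking is an order-theoretic notion (incomparable with v, below/above
--    u), so two representations of one order with the same containments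
--    satisfy (1)-(3) simultaneously  (Representation, transfer-cond1/2/3).
module Submission where

open import Defs
open import Level using (0ℓ)
open import Data.Nat using (ℕ)
open import Data.Fin using (Fin; _≟_)
open import Data.Product using (_×_; _,_; proj₁; proj₂; map)
open import Data.Sum using (_⊎_; inj₁; inj₂)
open import Data.Empty using (⊥-elim)
open import Function using (id)
open import Function.Bundles using (_⇔_; mk⇔; Equivalence)
open import Function.Construct.Symmetry using (⇔-sym)
open import Function.Construct.Composition using (_⇔-∘_)
open import Data.Product.Function.NonDependent.Propositional using (_×-⇔_)
open import Function.Related.TypeIsomorphisms using (¬-cong-⇔)
open import Relation.Nullary using (¬_; yes; no)
open import Relation.Binary using (Rel; StrictTotalOrder; tri<; tri≈; tri>)
open import Relation.Binary.PropositionalEquality using (_≡_; _≢_; refl; sym; trans)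
import Relation.Binary.Construct.StrictToNonStrict as NonStrict
import Relation.Binary.Properties.StrictTotalOrder as StrictTotalOrderProperties

Incomparable : ∀ {n} → Rel (Fin n) 0ℓ → Fin n → Fin n → Set
Incomparable _≺_ a b = ¬ (a ≺ b) × ¬ (b ≺ a)

UpdateOf : ∀ {b} {B : Set b} {n} → (Fin n → B) → (Fin n → B) → Fin n → B → Set b
UpdateOf f' f p q = f' p ≡ q × (∀ w → w ≢ p → f' w ≡ f w)

module Representations {c ℓ₁ ℓ₂} (A : StrictTotalOrder c ℓ₁ ℓ₂) where
  open StrictTotalOrder A using (_≈_; _<_; compare; irrefl; <-resp-≈; module Eq)
    renaming (Carrier to E; trans to <-trans)
  open Intervals A
  open StrictTotalOrderProperties A using ()
    renaming (refl to ≤-refl; trans to ≤-trans; antisym to ≤-antisym; reflexive to ≈⇒≤)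

  module EndpointOrder where

    <⇒≤ : ∀ {p q} → p < q → p ≤ q
    <⇒≤ = inj₁

    <-≤-trans : ∀ {p q r} → p < q → q ≤ r → p < r
    <-≤-trans = NonStrict.<-≤-trans _≈_ _<_ <-trans (proj₁ <-resp-≈)

    ≤-<-trans : ∀ {p q r} → p ≤ q → q < r → p < r
    ≤-<-trans = NonStrict.≤-<-trans _≈_ _<_ Eq.sym <-trans (proj₂ <-resp-≈)

    ≤⇒≯ : ∀ {p q} → p ≤ q → ¬ (q < p)
    ≤⇒≯ p≤q q<p = irrefl Eq.refl (<-≤-trans q<p p≤q)

    <⊎≥ : ∀ p q → p < q ⊎ q ≤ p
    <⊎≥ p q with compare p q
    ... | tri< p<q _ _ = inj₁ p<q
    ... | tri≈ _ p≈q _ = inj₂ (≈⇒≤ (Eq.sym p≈q))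
    ... | tri> _ _ q<p = inj₂ (<⇒≤ q<p)

    ≮⇒≥ : ∀ {p q} → ¬ (p < q) → q ≤ p
    ≮⇒≥ {p} {q} p≮q with <⊎≥ p q
    ... | inj₁ p<q = ⊥-elim (p≮q p<q)
    ... | inj₂ q≤p = q≤p

    ≰⇒> : ∀ {p q} → ¬ (p ≤ q) → q < p
    ≰⇒> {p} {q} p≰q with <⊎≥ q p
    ... | inj₁ q<p = q<p
    ... | inj₂ p≤q = ⊥-elim (p≰q p≤q)

    ≈⇔≤≥ : ∀ {p q} → p ≈ q ⇔ (p ≤ q × q ≤ p)
    ≈⇔≤≥ = mk⇔ (λ p≈q → ≈⇒≤ p≈q , ≈⇒≤ (Eq.sym p≈q)) (λ (p≤q , q≤p) → ≤-antisym p≤q q≤p)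

    above-unchanged : ∀ {p q c} → p ≤ q → ¬ (p < c × c ≤ q) → (p < c ⇔ q < c)
    above-unchanged p≤q gap =
      mk⇔ (λ p<c → ≰⇒> (λ c≤q → gap (p<c , c≤q))) (≤-<-trans p≤q)

    below-unchanged : ∀ {p q c} → p ≤ q → ¬ (p ≤ c × c < q) → (c < p ⇔ c < q)
    below-unchanged p≤q gap =
      mk⇔ (λ c<p → <-≤-trans c<p p≤q) (λ c<q → ≰⇒> (λ p≤c → gap (p≤c , c<q)))

    comparisons-unchanged : ∀ {p q c} → p ≤ q → ¬ (p ≤ c × c ≤ q) →
                            (p ≤ c ⇔ q ≤ c) × (c ≤ p ⇔ c ≤ q)
    comparisons-unchanged p≤q gap =
      mk⇔ (λ p≤c → <⇒≤ (≰⇒> (λ c≤q → gap (p≤c , c≤q)))) (≤-trans p≤q) ,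
      mk⇔ (λ c≤p → ≤-trans c≤p p≤q) (λ c≤q → <⇒≤ (≰⇒> (λ p≤c → gap (p≤c , c≤q))))

  open EndpointOrder

  module PointUpdate {n : ℕ} where

    update-≤ : ∀ {f' f : Fin n → E} {p q} → UpdateOf f' f p q →
               (∀ b → b ≢ p → (q ≤ f b ⇔ f p ≤ f b) × (f b ≤ q ⇔ f b ≤ f p)) →
               ∀ a b → f' a ≤ f' b ⇔ f a ≤ f b
    update-≤ {p = p} (at , off) same a b with a ≟ p | b ≟ p
    ... | yes refl | yes refl rewrite at = mk⇔ (λ _ → ≤-refl) (λ _ → ≤-refl)
    ... | yes refl | no b≢p rewrite at | off b b≢p = proj₁ (same b b≢p)
    ... | no a≢p | yes refl rewrite at | off a a≢p = proj₂ (same a a≢p)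
    ... | no a≢p | no b≢p rewrite off a a≢p | off b b≢p = mk⇔ id id

    update-<ˡ : ∀ {f' f g : Fin n → E} {p q} → UpdateOf f' f p q →
                (∀ b → q < g b ⇔ f p < g b) → ∀ a b → f' a < g b ⇔ f a < g b
    update-<ˡ {p = p} (at , off) same a b with a ≟ p
    ... | yes refl rewrite at = same b
    ... | no a≢p rewrite off a a≢p = mk⇔ id id

    update-<ʳ : ∀ {f g' g : Fin n → E} {p q} → UpdateOf g' g p q →
                (∀ a → f a < q ⇔ f a < g p) → ∀ a b → f a < g' b ⇔ f a < g b
    update-<ʳ {p = p} (at , off) same a b with b ≟ p
    ... | yes refl rewrite at = same a
    ... | no b≢p rewrite off b b≢p = mk⇔ id id

    hatL-update : ∀ (L R : Fin n → E) v x y → UpdateOf (hatL L R v x y) L y (R v)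
    hatL-update L R v x y = at , off
      where
      at : hatL L R v x y y ≡ R v
      at with y ≟ y
      ... | yes _ = refl
      ... | no y≢y = ⊥-elim (y≢y refl)
      off : ∀ w → w ≢ y → hatL L R v x y w ≡ L w
      off w w≢y with w ≟ y
      ... | yes w≡y = ⊥-elim (w≢y w≡y)
      ... | no _ = refl

    hatR-update : ∀ (L R : Fin n → E) v x y → UpdateOf (hatR L R v x y) R x (L v)
    hatR-update L R v x y = at , off
      where
      at : hatR L R v x y x ≡ L v
      at with x ≟ x
      ... | yes _ = refl
      ... | no x≢x = ⊥-elim (x≢x refl)
      off : ∀ w → w ≢ x → hatR L R v x y w ≡ R w
      off w w≢x with w ≟ x
      ... | yes w≡x = ⊥-elim (w≢x w≡x)
      ... | no _ = refl

  open PointUpdate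

  module Containment {n : ℕ} where

    strictly-inside-left : ∀ (L R : Fin n → E) {a b} → L b < L a → R a ≤ R b → SSub L R a b
    strictly-inside-left L R Lb<La Ra≤Rb =
      (<⇒≤ Lb<La , Ra≤Rb) , λ (La≈Lb , _) → irrefl (Eq.sym La≈Lb) Lb<La

    strictly-inside-right : ∀ (L R : Fin n → E) {a b} → L b ≤ L a → R a < R b → SSub L R a b
    strictly-inside-right L R Lb≤La Ra<Rb =
      (Lb≤La , <⇒≤ Ra<Rb) , λ (_ , Ra≈Rb) → irrefl Ra≈Rb Ra<Rb

    ssub-invariant : ∀ {L R L' R' : Fin n → E} →
                     (∀ a b → L' a ≤ L' b ⇔ L a ≤ L b) → (∀ a b → R' a ≤ R' b ⇔ R a ≤ R b) →
                     ∀ a b → SSub L' R' a b ⇔ SSub L R a b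
    ssub-invariant sameL sameR a b =
      (sameL b a ×-⇔ sameR a b) ×-⇔ ¬-cong-⇔ (same-≈ sameL a b ×-⇔ same-≈ sameR a b)
      where
      same-≈ : ∀ {f' f : Fin n → E} → (∀ a b → f' a ≤ f' b ⇔ f a ≤ f b) →
               ∀ a b → f' a ≈ f' b ⇔ f a ≈ f b
      same-≈ same a b = ⇔-sym ≈⇔≤≥ ⇔-∘ ((same a b ×-⇔ same b a) ⇔-∘ ≈⇔≤≥)

  open Containment

  module Representation {n : ℕ} {_≺_ : Rel (Fin n) 0ℓ} {L R : Fin n → E}
                        (rep : IsRep _≺_ L R) where

    valid : ∀ a → L a ≤ R a
    valid = proj₁ rep

    ≺⇒< : ∀ {a b} → a ≺ b → R a < L b
    ≺⇒< {a} {b} = Equivalence.to (proj₂ rep a b)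

    <⇒≺ : ∀ {a b} → R a < L b → a ≺ b
    <⇒≺ {a} {b} = Equivalence.from (proj₂ rep a b)

    ≺-irrefl : ∀ {a} → ¬ (a ≺ a)
    ≺-irrefl {a} a≺a = ≤⇒≯ (valid a) (≺⇒< a≺a)

    ≺-asym : ∀ {a b} → a ≺ b → ¬ (b ≺ a)
    ≺-asym {a} {b} a≺b b≺a =
      ≤⇒≯ (valid a) (<-trans (≺⇒< a≺b) (≤-<-trans (valid b) (≺⇒< b≺a)))

    meets⇔incomparable : ∀ {a b} → Meets L R a b ⇔ Incomparable _≺_ a b
    meets⇔incomparable =
      mk⇔ (λ (La≤Rb , Lb≤Ra) → (λ a≺b → ≤⇒≯ Lb≤Ra (≺⇒< a≺b)) ,
                               (λ b≺a → ≤⇒≯ La≤Rb (≺⇒< b≺a)))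
          (λ (a⊀b , b⊀a) → ≮⇒≥ (λ Rb<La → b⊀a (<⇒≺ Rb<La)) ,
                           ≮⇒≥ (λ Ra<Lb → a⊀b (<⇒≺ Ra<Lb)))

    peeksLeft⇔ : ∀ {z v u} → PeeksLeft L R z v u ⇔ (Incomparable _≺_ z v × z ≺ u)
    peeksLeft⇔ {z} {v} {u} =
      mk⇔ (λ ((Mzv , ¬Mzu) , Rz≤Lu) →
                Equivalence.to meets⇔incomparable Mzv ,
                <⇒≺ (≰⇒> (λ Lu≤Rz → ¬Mzu (≤-trans (valid z) (≤-trans Rz≤Lu (valid u)) , Lu≤Rz))))
          (λ (z∥v , z≺u) →
                (Equivalence.from meets⇔incomparable z∥v ,
                 (λ Mzu → proj₁ (Equivalence.to meets⇔incomparable Mzu) z≺u)) ,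
                <⇒≤ (≺⇒< z≺u))

    peeksRight⇔ : ∀ {z v u} → PeeksRight L R z v u ⇔ (Incomparable _≺_ z v × u ≺ z)
    peeksRight⇔ {z} {v} {u} =
      mk⇔ (λ ((Mzv , ¬Mzu) , Ru≤Lz) →
                Equivalence.to meets⇔incomparable Mzv ,
                <⇒≺ (≰⇒> (λ Lz≤Ru → ¬Mzu (Lz≤Ru , ≤-trans (valid u) (≤-trans Ru≤Lz (valid z))))))
          (λ (z∥v , u≺z) →
                (Equivalence.from meets⇔incomparable z∥v ,
                 (λ Mzu → proj₂ (Equivalence.to meets⇔incomparable Mzu) u≺z)) ,
                <⇒≤ (≺⇒< u≺z))

  module _ {n : ℕ} {_≺_ : Rel (Fin n) 0ℓ} {L R L' R' : Fin n → E}
           (rep : IsRep _≺_ L R) (rep' : IsRep _≺_ L' R')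
           (same : ∀ a b → SSub L' R' a b ⇔ SSub L R a b) where
    private
      module Old = Representation rep
      module New = Representation rep'
      old : ∀ {a b} → SSub L' R' a b → SSub L R a b
      old {a} {b} = Equivalence.to (same a b)

    transfer-cond1 : Cond1 L R → Cond1 L' R'
    transfer-cond1 c1 w a b a⊊w b⊊w = c1 w a b (old a⊊w) (old b⊊w)

    transfer-cond2 : Cond2 L R → Cond2 L' R'
    transfer-cond2 c2 w a b w⊊a w⊊b = c2 w a b (old w⊊a) (old w⊊b)

    transfer-cond3 : Cond3 L R → Cond3 L' R'
    transfer-cond3 c3 a b a⊊b with c3 a b (old a⊊b)
    ... | (l , l-peeks , l-unique) , (r , r-peeks , r-unique) =
      (l , left-new l-peeks , λ l' p → l-unique l' (left-old p)) ,
      (r , right-new r-peeks , λ r' p → r-unique r' (right-old p))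
      where
      left-new : ∀ {z} → PeeksLeft L R z b a → PeeksLeft L' R' z b a
      left-new p = Equivalence.from New.peeksLeft⇔ (Equivalence.to Old.peeksLeft⇔ p)
      left-old : ∀ {z} → PeeksLeft L' R' z b a → PeeksLeft L R z b a
      left-old p = Equivalence.from Old.peeksLeft⇔ (Equivalence.to New.peeksLeft⇔ p)
      right-new : ∀ {z} → PeeksRight L R z b a → PeeksRight L' R' z b a
      right-new p = Equivalence.from New.peeksRight⇔ (Equivalence.to Old.peeksRight⇔ p)
      right-old : ∀ {z} → PeeksRight L' R' z b a → PeeksRight L R z b a
      right-old p = Equivalence.from Old.peeksRight⇔ (Equivalence.to New.peeksRight⇔ p)

  module Configuration {n : ℕ} {_≺_ : Rel (Fin n) 0ℓ} {L R : Fin n → E}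
                       (rep : IsRep _≺_ L R) (c1 : Cond1 L R) (c2 : Cond2 L R) (c3 : Cond3 L R)
                       {u v x y : Fin n} (u⊊v : SSub L R u v)
                       (x-peeks : PeeksLeft L R x v u) (y-peeks : PeeksRight L R y v u) where
    open Representation rep

    x≺u : x ≺ u
    x≺u = proj₂ (Equivalence.to peeksLeft⇔ x-peeks)

    u≺y : u ≺ y
    u≺y = proj₂ (Equivalence.to peeksRight⇔ y-peeks)

    Rx<Lu : R x < L u
    Rx<Lu = ≺⇒< x≺u

    Ru<Ly : R u < L y
    Ru<Ly = ≺⇒< u≺y

    Lv≤Lu : L v ≤ L u
    Lv≤Lu = proj₁ (proj₁ u⊊v)

    Ru≤Rv : R u ≤ R v
    Ru≤Rv = proj₂ (proj₁ u⊊v)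

    Lv≤Rx : L v ≤ R x
    Lv≤Rx = proj₂ (proj₁ (proj₁ x-peeks))

    Ly≤Rv : L y ≤ R v
    Ly≤Rv = proj₁ (proj₁ (proj₁ y-peeks))

    Rx<Rv : R x < R v
    Rx<Rv = <-≤-trans Rx<Lu (≤-trans (valid u) Ru≤Rv)

    Lv<Ly : L v < L y
    Lv<Ly = ≤-<-trans (≤-trans Lv≤Lu (valid u)) Ru<Ly

    x≢y : x ≢ y
    x≢y refl = ≺-asym x≺u u≺y

    -- x and y stick out of v: otherwise, by (1), they would coincide with u.
    Lx<Lv : L x < L v
    Lx<Lv = ≰⇒> λ Lv≤Lx →
      ≺-irrefl (subst-≺ (c1 v x u (strictly-inside-right L R Lv≤Lx Rx<Rv) u⊊v))
      where subst-≺ : x ≡ u → u ≺ u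
            subst-≺ refl = x≺u

    Rv<Ry : R v < R y
    Rv<Ry = ≰⇒> λ Ry≤Rv →
      ≺-irrefl (subst-≺ (c1 v y u (strictly-inside-left L R Lv<Ly Ry≤Rv) u⊊v))
      where subst-≺ : y ≡ u → u ≺ u
            subst-≺ refl = u≺y

    -- No left endpoint lies in (L v, R x]: such an interval would either lie
    -- strictly inside v (so equal u by (1)) or strictly contain u (so equal v by (2)).
    no-left-endpoint-in-gap : ∀ b → ¬ (L v < L b × L b ≤ R x)
    no-left-endpoint-in-gap b (Lv<Lb , Lb≤Rx) with <⊎≥ (R b) (R v)
    ... | inj₁ Rb<Rv = b≢u (c1 v b u (strictly-inside-left L R Lv<Lb (<⇒≤ Rb<Rv)) u⊊v)
      where b≢u : b ≢ u
            b≢u refl = ≤⇒≯ Lb≤Rx Rx<Lu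
    ... | inj₂ Rv≤Rb = v≢b (c2 u v b u⊊v (strictly-inside-left L R Lb<Lu (≤-trans Ru≤Rv Rv≤Rb)))
      where Lb<Lu : L b < L u
            Lb<Lu = ≤-<-trans Lb≤Rx Rx<Lu
            v≢b : v ≢ b
            v≢b refl = irrefl Eq.refl Lv<Lb

    no-right-endpoint-in-gap : ∀ b → ¬ (L y ≤ R b × R b < R v)
    no-right-endpoint-in-gap b (Ly≤Rb , Rb<Rv) with <⊎≥ (L b) (L v)
    ... | inj₂ Lv≤Lb = b≢u (c1 v b u (strictly-inside-right L R Lv≤Lb Rb<Rv) u⊊v)
      where b≢u : b ≢ u
            b≢u refl = ≤⇒≯ Ly≤Rb Ru<Ly
    ... | inj₁ Lb<Lv = v≢b (c2 u v b u⊊v (strictly-inside-right L R (≤-trans (<⇒≤ Lb<Lv) Lv≤Lu) Ru<Rb))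
      where Ru<Rb : R u < R b
            Ru<Rb = <-≤-trans Ru<Ly Ly≤Rb
            v≢b : v ≢ b
            v≢b refl = irrefl Eq.refl Rb<Rv

    left-peeker-by-endpoint : ∀ b → Meets L R b v → R b ≤ R x → b ≡ x
    left-peeker-by-endpoint b Mbv Rb≤Rx with proj₁ (c3 u v u⊊v)
    ... | _ , _ , unique = trans (unique b b-peeks) (sym (unique x x-peeks))
      where b-peeks : PeeksLeft L R b v u
            b-peeks = Equivalence.from peeksLeft⇔
              (Equivalence.to meets⇔incomparable Mbv , <⇒≺ (≤-<-trans Rb≤Rx Rx<Lu))

    right-peeker-by-endpoint : ∀ b → Meets L R b v → L y ≤ L b → b ≡ y
    right-peeker-by-endpoint b Mbv Ly≤Lb with proj₂ (c3 u v u⊊v)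
    ... | _ , _ , unique = trans (unique b b-peeks) (sym (unique y y-peeks))
      where b-peeks : PeeksRight L R b v u
            b-peeks = Equivalence.from peeksRight⇔
              (Equivalence.to meets⇔incomparable Mbv , <⇒≺ (<-≤-trans Ru<Ly Ly≤Lb))

    right-endpoints-avoid-gap : ∀ b → b ≢ x → ¬ (L v ≤ R b × R b ≤ R x)
    right-endpoints-avoid-gap b b≢x (Lv≤Rb , Rb≤Rx) =
      b≢x (left-peeker-by-endpoint b (≤-trans (valid b) (≤-trans Rb≤Rx (<⇒≤ Rx<Rv)) , Lv≤Rb) Rb≤Rx)

    left-endpoints-avoid-gap : ∀ b → b ≢ y → ¬ (L y ≤ L b × L b ≤ R v)
    left-endpoints-avoid-gap b b≢y (Ly≤Lb , Lb≤Rv) =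
      b≢y (right-peeker-by-endpoint b (Lb≤Rv , ≤-trans (<⇒≤ Lv<Ly) (≤-trans Ly≤Lb (valid b))) Ly≤Lb)

  module Modification {n : ℕ} {_≺_ : Rel (Fin n) 0ℓ} {L R : Fin n → E}
                      (rep : IsRep _≺_ L R) (c1 : Cond1 L R) (c2 : Cond2 L R) (c3 : Cond3 L R)
                      {u v x y : Fin n} (u⊊v : SSub L R u v)
                      (x-peeks : PeeksLeft L R x v u) (y-peeks : PeeksRight L R y v u)
                      {L' R' : Fin n → E}
                      (L'-update : UpdateOf L' L y (R v)) (R'-update : UpdateOf R' R x (L v)) where
    open Representation rep
    open Configuration rep c1 c2 c3 u⊊v x-peeks y-peeks

    valid' : ∀ w → L' w ≤ R' w
    valid' w with w ≟ x | w ≟ y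
    ... | yes refl | yes x≡y = ⊥-elim (x≢y x≡y)
    ... | yes refl | no _ rewrite proj₁ R'-update | proj₂ L'-update x x≢y = <⇒≤ Lx<Lv
    ... | no y≢x | yes refl rewrite proj₁ L'-update | proj₂ R'-update y y≢x = <⇒≤ Rv<Ry
    ... | no w≢x | no w≢y rewrite proj₂ L'-update w w≢y | proj₂ R'-update w w≢x = valid w

    no-new-left-endpoint-in-gap : ∀ b → ¬ (L v < L' b × L' b ≤ R x)
    no-new-left-endpoint-in-gap b with b ≟ y
    ... | yes refl rewrite proj₁ L'-update = λ (_ , Rv≤Rx) → ≤⇒≯ Rv≤Rx Rx<Rv
    ... | no b≢y rewrite proj₂ L'-update b b≢y = no-left-endpoint-in-gap b

    -- Every comparison between a right and a left endpoint is unchanged: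
    -- first move R x (no L' b in (L v, R x]), then L y (no R a in [L y, R v)).
    crossings-unchanged : ∀ a b → R' a < L' b ⇔ R a < L b
    crossings-unchanged a b = move-Ly ⇔-∘ move-Rx
      where
      move-Rx : R' a < L' b ⇔ R a < L' b
      move-Rx = update-<ˡ R'-update (λ b → above-unchanged Lv≤Rx (no-new-left-endpoint-in-gap b)) a b
      move-Ly : R a < L' b ⇔ R a < L b
      move-Ly = update-<ʳ L'-update (λ a → ⇔-sym (below-unchanged Ly≤Rv (no-right-endpoint-in-gap a))) a b

    rep' : IsRep _≺_ L' R'
    rep' = valid' , λ a b → ⇔-sym (crossings-unchanged a b) ⇔-∘ proj₂ rep a b

    left-endpoints-order : ∀ a b → L' a ≤ L' b ⇔ L a ≤ L b
    left-endpoints-order = update-≤ L'-update λ b b≢y →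
      map ⇔-sym ⇔-sym (comparisons-unchanged Ly≤Rv (left-endpoints-avoid-gap b b≢y))

    right-endpoints-order : ∀ a b → R' a ≤ R' b ⇔ R a ≤ R b
    right-endpoints-order = update-≤ R'-update λ b b≢x →
      comparisons-unchanged Lv≤Rx (right-endpoints-avoid-gap b b≢x)

    same-containments : ∀ a b → SSub L' R' a b ⇔ SSub L R a b
    same-containments = ssub-invariant left-endpoints-order right-endpoints-order

proposition14 : ∀ {c ℓ₁ ℓ₂} (A : StrictTotalOrder c ℓ₁ ℓ₂) {n : ℕ}
    (_≺_ : Rel (Fin n) Level.zero) → IsPoset _≺_ → TwinFree _≺_ → Forbidden _≺_ →
    (L R : Fin n → StrictTotalOrder.Carrier A) →
    let open Intervals A in
    IsRep _≺_ L R → Cond1 L R → Cond2 L R → Cond3 L R →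
    (u v x y : Fin n) → SSub L R u v → PeeksLeft L R x v u → PeeksRight L R y v u →
    let L' = hatL L R v x y
        R' = hatR L R v x y
    in IsRep _≺_ L' R' × Cond1 L' R' × Cond2 L' R' × Cond3 L' R' ×
       (∀ a b → SSub L' R' a b ⇔ SSub L R a b)
proposition14 A _≺_ _ _ _ L R rep c1 c2 c3 u v x y u⊊v x-peeks y-peeks =
  rep' ,
  transfer-cond1 rep rep' same-containments c1 ,
  transfer-cond2 rep rep' same-containments c2 ,
  transfer-cond3 rep rep' same-containments c3 ,
  same-containments
  where
  open Representations A
  open PointUpdate
  open Modification rep c1 c2 c3 u⊊v x-peeks y-peeks
                    (hatL-update L R v x y) (hatR-update L R v x y)
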